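{- Combinatorial reduction strategies are path invariant: if $G$ is a graph and $(\gamma_1,\dots,\gamma_k)$ and $(\delta_1,\dots,\delta_l)$ are two applicable combinatorial reduction strategies of $G$ with the same domain, then $\gamma_k\circ\cdots\circ\gamma_1(G)=\delta_l\circ\cdots\circ\delta_1(G)$.
   Context: A graph is a finite graph with vertex set $V$, no multiple edges, in which each vertex may or may not carry a loop. Its adjacency matrix $A$ is the symmetric $V\times V$ matrix over $\mathbf{F}_2$ with $A_{vw}=1$ iff $v\ne w$ are adjacent and $A_{vv}=1$ iff $v$ has a loop. Combinatorial reduction rules (domain listed first in block form, arithmetic over $\mathbf{F}_2$): $\mathrm{gpr}_v$ applies iff $v$ has a loop; domain $\{v\}$; if $A=\begin{pmatrix}1&q\\ q^T&R\end{pmatrix}$, the result is the graph on $V\setminus\{v\}$ with adjacency matrix $R-q^Tq$. $\mathrm{gdr}_{v_1,v_2}$ applies iff $v_1\neq v_2$ are loopless and adjacent; domain $\{v_1,v_2\}$; if $A=\begin{pmatrix}J&Q\\ Q^T&R\end{pmatrix}$ with $J=\begin{pmatrix}0&1\\1&0\end{pmatrix}$, the result is the graph on $V\setminus\{v_1,v_2\}$ with adjacency matrix $R-Q^TJQ$. $\mathrm{gnr}_v$ applies iff $v$ is loopless with no neighbours; domain $\{v\}$; the result is $G$ with $v$ deleted. A combinatorial reduction strategy is a sequence $(\gamma_1,\dots,\gamma_k)$ of rules; it is applicable if each $\gamma_i$ applies to $\gamma_{i-1}\circ\cdots\circ\gamma_1(G)$; its domain is the set of all vertices removed. -}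

module Defs where

open import Data.Nat using (ℕ)
open import Data.Fin using (Fin)
open import Data.Bool using (Bool; true; false; _∧_; _∨_; _xor_; not)
open import Data.List using (List; []; _∷_)
open import Data.Product using (_×_)
open import Data.Unit using (⊤)
open import Relation.Binary.PropositionalEquality using (_≡_)
open import Relation.Nullary using (¬_)

-- A graph whose vertex set is a subset of the ambient finite set Fin n.
-- 'verts v ≡ true' iff v is a vertex; 'adj v w' is the F₂-entry A_vw
-- (only meaningful for v, w vertices; A_vv = 1 iff v has a loop).
record Graph (n : ℕ) : Set where
  constructor mkGraph
  field
    verts : Fin n → Bool
    adj   : Fin n → Fin n → Bool
open Graph public

Symmetric : ∀ {n} → Graph n → Set
Symmetric G = ∀ v w → adj G v w ≡ adj G w v

_≅_ : ∀ {n} → Graph n → Graph n → Set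
G ≅ H = (∀ v → verts G v ≡ verts H v)
      × (∀ v w → verts G v ≡ true → verts G w ≡ true → adj G v w ≡ adj H v w)

data Rule (n : ℕ) : Set where
  gpr : Fin n → Rule n
  gdr : Fin n → Fin n → Rule n
  gnr : Fin n → Rule n

module _ {n : ℕ} where
  open import Data.Fin using (_≟_)
  open import Relation.Nullary using (does)

  isV : Fin n → Fin n → Bool
  isV v x = does (v ≟ x)

ruleDom : ∀ {n} → Rule n → Fin n → Bool
ruleDom (gpr v)     x = isV v x
ruleDom (gdr v₁ v₂) x = isV v₁ x ∨ isV v₂ x
ruleDom (gnr v)     x = isV v x

Applies : ∀ {n} → Graph n → Rule n → Set
Applies G (gpr v) = verts G v ≡ true × adj G v v ≡ true
Applies G (gdr v₁ v₂) =
  ¬ (v₁ ≡ v₂) × verts G v₁ ≡ true × verts G v₂ ≡ true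
  × adj G v₁ v₁ ≡ false × adj G v₂ v₂ ≡ false × adj G v₁ v₂ ≡ true
Applies G (gnr v) =
  verts G v ≡ true × adj G v v ≡ false
  × (∀ w → verts G w ≡ true → ¬ (w ≡ v) → adj G v w ≡ false)

-- result of applying a rule (over F₂, subtraction = addition = xor)
apply : ∀ {n} → Graph n → Rule n → Graph n
apply G r = mkGraph (λ x → verts G x ∧ not (ruleDom r x)) (newAdj r)
  where
  newAdj : Rule _ → Fin _ → Fin _ → Bool
  -- R - qᵀq :  R_xy + A_vx A_vy
  newAdj (gpr v) x y = adj G x y xor (adj G v x ∧ adj G v y)
  -- R - QᵀJQ : R_xy + A_{v₁x} A_{v₂y} + A_{v₂x} A_{v₁y}
  newAdj (gdr v₁ v₂) x y =
    adj G x y xor ((adj G v₁ x ∧ adj G v₂ y) xor (adj G v₂ x ∧ adj G v₁ y))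
  newAdj (gnr v) x y = adj G x y

Strategy : ℕ → Set
Strategy n = List (Rule n)

run : ∀ {n} → Graph n → Strategy n → Graph n
run G []       = G
run G (r ∷ rs) = run (apply G r) rs

Applicable : ∀ {n} → Graph n → Strategy n → Set
Applicable G []       = ⊤
Applicable G (r ∷ rs) = Applies G r × Applicable (apply G r) rs

dom : ∀ {n} → Strategy n → Fin n → Bool
dom []       x = false
dom (r ∷ rs) x = ruleDom r x ∨ dom rs x

module Submission where

-- Write A for the adjacency matrix of G over F₂ (on the whole ambient set
-- Fin n).  For a set D of vertices and a vertex y, call z a D-extension of y
-- if z agrees with the unit vector e_y outside D and A z vanishes on D.
-- The proof rests on two facts about such extensions.
--
--  * Uniqueness (needs only symmetry of A): if x ∉ D also has a
--    D-extension u, then (A z)_x does not depend on the D-extension z of y,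
--    because for the difference d of two of them
--        (A d)_x = u · A d = d · A u = 0.
--  * Existence: running an applicable strategy with domain D from G, every
--    surviving vertex y has a D-extension z with (A z)_x = adj x y for all
--    surviving x.  Each rule is a pivot, so an extension for the reduced
--    matrix lifts to one for A by correcting it on the rule's domain.
--
-- Hence the adjacency of the final graph is determined by A and D alone,
-- and its vertex set is that of G minus D; this is the theorem.

open import Defs
open import Data.Nat using (ℕ; suc)
open import Data.Fin using (Fin; _≟_; punchIn)
open import Data.Fin.Properties using (punchInᵢ≢i)
open import Data.Bool using (Bool; true; false; _∧_; _∨_; _xor_; not)
open import Data.Bool.Properties
  using ( ∧-comm; ∧-assoc; ∧-zeroʳ; ∧-identityʳ; ∧-conicalˡ; ∧-conicalʳ
        ; ∨-conicalˡ; ∨-conicalʳ; xor-comm; xor-assoc; xor-identityʳ; xor-same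
        ; ∧-distribˡ-xor; ∧-distribʳ-xor
        ; xor-∧-commutativeRing; ∨-∧-booleanAlgebra )
open import Algebra.Bundles using (CommutativeRing)
open import Algebra.Lattice.Properties.BooleanAlgebra ∨-∧-booleanAlgebra
  using (deMorgan₂)
open import Algebra.Properties.Semiring.Sum
  (CommutativeRing.semiring xor-∧-commutativeRing)
  using (sum; sum-cong-≗; sum-replicate-zero; sum-remove; ∑-distrib-+; ∑-comm
        ; *-distribˡ-sum)
open import Data.Vec.Functional using (Vector)
open import Data.List using ([]; _∷_)
open import Data.Product using (Σ-syntax; _,_; proj₁; proj₂)
open import Data.Sum using (_⊎_; inj₁; inj₂)
open import Function using (_∘_)
open import Relation.Nullary using (¬_; yes; no)
open import Relation.Nullary.Decidable using (dec-true; dec-false)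
open import Relation.Binary.PropositionalEquality
open ≡-Reasoning

private
  variable
    n : ℕ

xor-cancel : ∀ {a b} → a xor b ≡ false → a ≡ b
xor-cancel {false} {false} _ = refl
xor-cancel {true}  {true}  _ = refl

∨-true : ∀ {a b} → a ∨ b ≡ true → a ≡ true ⊎ b ≡ true
∨-true {true}  _ = inj₁ refl
∨-true {false} p = inj₂ p

not-true : ∀ {a} → not a ≡ true → a ≡ false
not-true {false} _ = refl

isV-refl : (v : Fin n) → isV v v ≡ true
isV-refl v = dec-true (v ≟ v) refl

isV-false : {v k : Fin n} → ¬ v ≡ k → isV v k ≡ false
isV-false {v = v} {k} = dec-false (v ≟ k)

isV-true : {v k : Fin n} → isV v k ≡ true → v ≡ k
isV-true {v = v} {k} p with v ≟ k
... | yes v≡k = v≡k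

Matrix : ℕ → Set
Matrix n = Fin n → Fin n → Bool

SymmetricMatrix : Matrix n → Set
SymmetricMatrix A = ∀ v w → A v w ≡ A w v

infixl 6 _⊕_
infixr 7 _•_
infix  5 _·_
infixr 8 _*ᵥ_

_⊕_ : Vector Bool n → Vector Bool n → Vector Bool n
(u ⊕ w) k = u k xor w k

_•_ : Bool → Vector Bool n → Vector Bool n
(c • w) k = c ∧ w k

_·_ : Vector Bool n → Vector Bool n → Bool
u · w = sum (λ k → u k ∧ w k)

_*ᵥ_ : Matrix n → Vector Bool n → Vector Bool n
(A *ᵥ z) x = A x · z

sum-zero : (f : Vector Bool n) → (∀ k → f k ≡ false) → sum f ≡ false
sum-zero {n} f f≡0 = trans (sum-cong-≗ f≡0) (sum-replicate-zero n)

sum-single : (f : Vector Bool n) (v : Fin n) →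
             (∀ k → ¬ k ≡ v → f k ≡ false) → sum f ≡ f v
sum-single {suc n} f v off-v = begin
  sum f                               ≡⟨ sum-remove {i = v} f ⟩
  f v xor sum (λ i → f (punchIn v i)) ≡⟨ cong (f v xor_) rest-zero ⟩
  f v xor false                       ≡⟨ xor-identityʳ (f v) ⟩
  f v                                 ∎
  where
  rest-zero : sum (λ i → f (punchIn v i)) ≡ false
  rest-zero = sum-zero _ (λ i → off-v _ (punchInᵢ≢i v i))

·-unitʳ : (u : Vector Bool n) (v : Fin n) → (u · isV v) ≡ u v
·-unitʳ u v = begin
  u · isV v       ≡⟨ sum-single _ v (λ k k≢v → trans (cong (u k ∧_) (isV-false (k≢v ∘ sym))) (∧-zeroʳ (u k))) ⟩
  u v ∧ isV v v   ≡⟨ cong (u v ∧_) (isV-refl v) ⟩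
  u v ∧ true      ≡⟨ ∧-identityʳ (u v) ⟩
  u v             ∎

·-comm : (u w : Vector Bool n) → (u · w) ≡ (w · u)
·-comm u w = sum-cong-≗ (λ k → ∧-comm (u k) (w k))

·-unitˡ : (v : Fin n) (w : Vector Bool n) → (isV v · w) ≡ w v
·-unitˡ v w = trans (·-comm (isV v) w) (·-unitʳ w v)

·-⊕ˡ : (u w z : Vector Bool n) → ((u ⊕ w) · z) ≡ (u · z) xor (w · z)
·-⊕ˡ u w z = trans (sum-cong-≗ (λ k → ∧-distribʳ-xor (z k) (u k) (w k)))
                   (∑-distrib-+ (λ k → u k ∧ z k) (λ k → w k ∧ z k))

·-⊕ʳ : (u w z : Vector Bool n) → (u · (w ⊕ z)) ≡ (u · w) xor (u · z)
·-⊕ʳ u w z = trans (sum-cong-≗ (λ k → ∧-distribˡ-xor (u k) (w k) (z k)))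
                   (∑-distrib-+ (λ k → u k ∧ w k) (λ k → u k ∧ z k))

·-•ˡ : (c : Bool) (w z : Vector Bool n) → ((c • w) · z) ≡ c ∧ (w · z)
·-•ˡ true  w z = refl
·-•ˡ false w z = sum-zero (λ k → (false • w) k ∧ z k) (λ _ → refl)

·-•ʳ : (c : Bool) (u w : Vector Bool n) → (u · (c • w)) ≡ c ∧ (u · w)
·-•ʳ true  u w = refl
·-•ʳ false u w = sum-zero _ (λ k → ∧-zeroʳ (u k))

·-*ᵥ-symmetric : {A : Matrix n} → SymmetricMatrix A →
                 (u d : Vector Bool n) → (u · A *ᵥ d) ≡ (d · A *ᵥ u)
·-*ᵥ-symmetric {A = A} symA u d = begin
  sum (λ k → u k ∧ sum (λ j → A k j ∧ d j))
    ≡⟨ sum-cong-≗ (λ k → *-distribˡ-sum (u k) (λ j → A k j ∧ d j)) ⟩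
  sum (λ k → sum (λ j → u k ∧ (A k j ∧ d j)))
    ≡⟨ ∑-comm (λ k j → u k ∧ (A k j ∧ d j)) ⟩
  sum (λ j → sum (λ k → u k ∧ (A k j ∧ d j)))
    ≡⟨ sum-cong-≗ (λ j → sum-cong-≗ (λ k → swap (u k) (d j) (symA k j))) ⟩
  sum (λ j → sum (λ k → d j ∧ (A j k ∧ u k)))
    ≡⟨ sum-cong-≗ (λ j → sym (*-distribˡ-sum (d j) (λ k → A j k ∧ u k))) ⟩
  sum (λ j → d j ∧ sum (λ k → A j k ∧ u k))
    ∎
  where
  swap : ∀ a b {c c′} → c ≡ c′ → a ∧ (c ∧ b) ≡ b ∧ (c′ ∧ a)
  swap a b refl = trans (sym (∧-assoc a _ b))
                 (trans (∧-comm (a ∧ _) b) (cong (b ∧_) (∧-comm a _)))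

*ᵥ-add-unit : (A : Matrix n) (z : Vector Bool n) (c : Bool) (v k : Fin n) →
              (A *ᵥ (z ⊕ c • isV v)) k ≡ (A *ᵥ z) k xor (A k v ∧ c)
*ᵥ-add-unit A z c v k = begin
  (A k · z ⊕ c • isV v)            ≡⟨ ·-⊕ʳ (A k) z _ ⟩
  (A k · z) xor (A k · c • isV v)  ≡⟨ cong ((A k · z) xor_) (·-•ʳ c (A k) (isV v)) ⟩
  (A k · z) xor (c ∧ (A k · isV v)) ≡⟨ cong (λ b → (A k · z) xor (c ∧ b)) (·-unitʳ (A k) v) ⟩
  (A k · z) xor (c ∧ A k v)        ≡⟨ cong ((A k · z) xor_) (∧-comm c (A k v)) ⟩
  (A k · z) xor (A k v ∧ c)        ∎

record Extension (A : Matrix n) (D : Vector Bool n) (y : Fin n) : Set where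
  constructor extension
  field
    vec      : Vector Bool n
    outside  : ∀ k → D k ≡ false → vec k ≡ isV y k
    harmonic : ∀ k → D k ≡ true → (A *ᵥ vec) k ≡ false
open Extension

extension-cong : {A : Matrix n} {D D′ : Vector Bool n} {y : Fin n} →
                 (∀ k → D k ≡ D′ k) → Extension A D y → Extension A D′ y
extension-cong D≡D′ (extension z out harm) =
  extension z (λ k p → out k (trans (D≡D′ k) p))
              (λ k p → harm k (trans (D≡D′ k) p))

extension-support : {A : Matrix n} {D : Vector Bool n} {y : Fin n} →
                    (z : Extension A D y) →
                    ∀ k → vec z k ≡ true → D k ≡ true ⊎ y ≡ k
extension-support {D = D} z k zk with D k in Dk
... | true  = inj₁ refl
... | false = inj₂ (isV-true (trans (sym (outside z k Dk)) zk))

-- With d = z + z′,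
-- (A d)_x = e_x · A d = u · A d = d · A u = 0, since on D the vectors
-- A d and A u vanish and off D the vectors u + e_x and d vanish.
extension-unique : {A : Matrix n} {D : Vector Bool n} {x y : Fin n} →
                   SymmetricMatrix A → D x ≡ false → Extension A D x →
                   (z z′ : Extension A D y) →
                   (A *ᵥ vec z) x ≡ (A *ᵥ vec z′) x
extension-unique {n} {A} {D} {x} {y} symA Dx u z z′ = xor-cancel (begin
  (A *ᵥ vec z) x xor (A *ᵥ vec z′) x  ≡⟨ sym (·-⊕ʳ (A x) (vec z) (vec z′)) ⟩
  (A *ᵥ d) x                           ≡⟨ sym (·-unitˡ x (A *ᵥ d)) ⟩
  (isV x · A *ᵥ d)                     ≡⟨ sum-cong-≗ e-x-to-u ⟩
  (vec u · A *ᵥ d)                     ≡⟨ ·-*ᵥ-symmetric symA (vec u) d ⟩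
  (d · A *ᵥ vec u)                     ≡⟨ sum-zero _ d⊥Au ⟩
  false                                ∎)
  where
  d : Vector Bool n
  d = vec z ⊕ vec z′

  Ad-vanishes : ∀ k → D k ≡ true → (A *ᵥ d) k ≡ false
  Ad-vanishes k Dk = begin
    (A *ᵥ d) k                          ≡⟨ ·-⊕ʳ (A k) (vec z) (vec z′) ⟩
    (A *ᵥ vec z) k xor (A *ᵥ vec z′) k  ≡⟨ cong₂ _xor_ (harmonic z k Dk) (harmonic z′ k Dk) ⟩
    false                               ∎

  e-x-to-u : ∀ k → isV x k ∧ (A *ᵥ d) k ≡ vec u k ∧ (A *ᵥ d) k
  e-x-to-u k with D k in Dk
  ... | false = cong (_∧ (A *ᵥ d) k) (sym (outside u k Dk))
  ... | true  = trans (annihilated (isV x k)) (sym (annihilated (vec u k)))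
    where
    annihilated : ∀ a → a ∧ (A *ᵥ d) k ≡ false
    annihilated a = trans (cong (a ∧_) (Ad-vanishes k Dk)) (∧-zeroʳ a)

  d⊥Au : ∀ k → d k ∧ (A *ᵥ vec u) k ≡ false
  d⊥Au k with D k in Dk
  ... | false = cong (_∧ (A *ᵥ vec u) k)
                  (trans (cong₂ _xor_ (outside z k Dk) (outside z′ k Dk)) (xor-same (isV y k)))
  ... | true  = trans (cong (d k ∧_) (harmonic u k Dk)) (∧-zeroʳ (d k))

symmetric-apply : (G : Graph n) → Symmetric G → ∀ r → Symmetric (apply G r)
symmetric-apply G symG (gpr v) x y =
  cong₂ _xor_ (symG x y) (∧-comm (adj G v x) (adj G v y))
symmetric-apply G symG (gdr v₁ v₂) x y =
  cong₂ _xor_ (symG x y)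
    (trans (xor-comm (adj G v₁ x ∧ adj G v₂ y) (adj G v₂ x ∧ adj G v₁ y))
           (cong₂ _xor_ (∧-comm (adj G v₂ x) (adj G v₁ y))
                        (∧-comm (adj G v₁ x) (adj G v₂ y))))
symmetric-apply G symG (gnr v) x y = symG x y

verts-run : (G : Graph n) (rs : Strategy n) (x : Fin n) →
            verts (run G rs) x ≡ verts G x ∧ not (dom rs x)
verts-run G []       x = sym (∧-identityʳ (verts G x))
verts-run G (r ∷ rs) x = begin
  verts (run (apply G r) rs) x                         ≡⟨ verts-run (apply G r) rs x ⟩
  (verts G x ∧ not (ruleDom r x)) ∧ not (dom rs x)     ≡⟨ ∧-assoc (verts G x) _ _ ⟩
  verts G x ∧ (not (ruleDom r x) ∧ not (dom rs x))     ≡⟨ cong (verts G x ∧_) (sym (deMorgan₂ (ruleDom r x) (dom rs x))) ⟩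
  verts G x ∧ not (ruleDom r x ∨ dom rs x)             ∎

verts-run-⊆ : (G : Graph n) (rs : Strategy n) {x : Fin n} →
              verts (run G rs) x ≡ true → verts G x ≡ true
verts-run-⊆ G rs {x} p = ∧-conicalˡ _ _ (trans (sym (verts-run G rs x)) p)

verts-run-∉dom : (G : Graph n) (rs : Strategy n) {x : Fin n} →
                 verts (run G rs) x ≡ true → dom rs x ≡ false
verts-run-∉dom G rs {x} p = not-true (∧-conicalʳ _ _ (trans (sym (verts-run G rs x)) p))

ruleDom-⊆ : (G : Graph n) (r : Rule n) → Applies G r →
            ∀ k → ruleDom r k ≡ true → verts G k ≡ true
ruleDom-⊆ G (gpr v) (Gv , _) k p = subst (λ w → verts G w ≡ true) (isV-true p) Gv
ruleDom-⊆ G (gnr v) (Gv , _) k p = subst (λ w → verts G w ≡ true) (isV-true p) Gv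
ruleDom-⊆ G (gdr v₁ v₂) (_ , Gv₁ , Gv₂ , _) k p with ∨-true p
... | inj₁ q = subst (λ w → verts G w ≡ true) (isV-true q) Gv₁
... | inj₂ q = subst (λ w → verts G w ≡ true) (isV-true q) Gv₂

dom-⊆ : (G : Graph n) (rs : Strategy n) → Applicable G rs →
        ∀ k → dom rs k ≡ true → verts G k ≡ true
dom-⊆ G (r ∷ rs) (ar , ars) k p with ∨-true p
... | inj₁ q = ruleDom-⊆ G r ar k q
... | inj₂ q = ∧-conicalˡ _ _ (dom-⊆ (apply G r) rs ars k q)

-- This is one pivot step of Gaussian elimination run backwards.
record Lift (G : Graph n) (r : Rule n) (z′ : Vector Bool n) : Set where
  constructor lift
  field
    lifted     : Vector Bool n
    agrees     : ∀ k → ruleDom r k ≡ false → lifted k ≡ z′ k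
    pivoted    : ∀ k → ruleDom r k ≡ true → (adj G *ᵥ lifted) k ≡ false
    same-image : ∀ k → (adj G *ᵥ lifted) k ≡ (adj (apply G r) *ᵥ z′) k
open Lift

add-unit-off : (z : Vector Bool n) (c : Bool) (v : Fin n) {k : Fin n} →
               isV v k ≡ false → (z ⊕ c • isV v) k ≡ z k
add-unit-off z c v {k} p = begin
  z k xor (c ∧ isV v k)  ≡⟨ cong (λ b → z k xor (c ∧ b)) p ⟩
  z k xor (c ∧ false)    ≡⟨ cong (z k xor_) (∧-zeroʳ c) ⟩
  z k xor false          ≡⟨ xor-identityʳ (z k) ⟩
  z k                    ∎

lift-gpr : (G : Graph n) → Symmetric G → (v : Fin n) → adj G v v ≡ true →
           (z′ : Vector Bool n) → Lift G (gpr v) z′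
lift-gpr G symG v Avv z′ = lift (z′ ⊕ c • isV v) (λ k → add-unit-off z′ c v) pivot image
  where
  A : Matrix _
  A = adj G

  c : Bool
  c = (A *ᵥ z′) v

  pivot : ∀ k → isV v k ≡ true → (A *ᵥ (z′ ⊕ c • isV v)) k ≡ false
  pivot k p with refl ← isV-true {v = v} {k} p = begin
    (A *ᵥ (z′ ⊕ c • isV v)) v  ≡⟨ *ᵥ-add-unit A z′ c v v ⟩
    c xor (A v v ∧ c)          ≡⟨ cong (λ b → c xor (b ∧ c)) Avv ⟩
    c xor c                    ≡⟨ xor-same c ⟩
    false                      ∎

  image : ∀ k → (A *ᵥ (z′ ⊕ c • isV v)) k ≡ (adj (apply G (gpr v)) *ᵥ z′) k
  image k = begin
    (A *ᵥ (z′ ⊕ c • isV v)) k           ≡⟨ *ᵥ-add-unit A z′ c v k ⟩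
    (A *ᵥ z′) k xor (A k v ∧ c)         ≡⟨ cong (λ b → (A *ᵥ z′) k xor (b ∧ c)) (symG k v) ⟩
    (A *ᵥ z′) k xor (A v k ∧ c)         ≡⟨ cong ((A *ᵥ z′) k xor_) (sym (·-•ˡ (A v k) (A v) z′)) ⟩
    (A *ᵥ z′) k xor (A v k • A v · z′)  ≡⟨ sym (·-⊕ˡ (A k) (A v k • A v) z′) ⟩
    (A k ⊕ A v k • A v · z′)            ∎

lift-gdr : (G : Graph n) → Symmetric G → (v₁ v₂ : Fin n) →
           adj G v₁ v₁ ≡ false → adj G v₂ v₂ ≡ false → adj G v₁ v₂ ≡ true →
           (z′ : Vector Bool n) → Lift G (gdr v₁ v₂) z′
lift-gdr G symG v₁ v₂ A11 A22 A12 z′ = lift z agree pivot image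
  where
  A : Matrix _
  A = adj G

  c₁ c₂ : Bool
  c₁ = (A *ᵥ z′) v₁
  c₂ = (A *ᵥ z′) v₂

  z : Vector Bool _
  z = z′ ⊕ c₂ • isV v₁ ⊕ c₁ • isV v₂

  Az : ∀ k → (A *ᵥ z) k ≡ ((A *ᵥ z′) k xor (A k v₁ ∧ c₂)) xor (A k v₂ ∧ c₁)
  Az k = trans (*ᵥ-add-unit A (z′ ⊕ c₂ • isV v₁) c₁ v₂ k)
               (cong (_xor (A k v₂ ∧ c₁)) (*ᵥ-add-unit A z′ c₂ v₁ k))

  agree : ∀ k → (isV v₁ k ∨ isV v₂ k) ≡ false → z k ≡ z′ k
  agree k p = trans (add-unit-off (z′ ⊕ c₂ • isV v₁) c₁ v₂ (∨-conicalʳ (isV v₁ k) _ p))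
                    (add-unit-off z′ c₂ v₁ (∨-conicalˡ (isV v₁ k) _ p))

  pivot : ∀ k → (isV v₁ k ∨ isV v₂ k) ≡ true → (A *ᵥ z) k ≡ false
  pivot k p with ∨-true p
  ... | inj₁ q with refl ← isV-true {v = v₁} {k} q = begin
    (A *ᵥ z) v₁                                  ≡⟨ Az v₁ ⟩
    (c₁ xor (A v₁ v₁ ∧ c₂)) xor (A v₁ v₂ ∧ c₁)  ≡⟨ cong₂ (λ a b → (c₁ xor (a ∧ c₂)) xor (b ∧ c₁)) A11 A12 ⟩
    (c₁ xor false) xor c₁                        ≡⟨ cong (_xor c₁) (xor-identityʳ c₁) ⟩
    c₁ xor c₁                                    ≡⟨ xor-same c₁ ⟩
    false                                        ∎
  ... | inj₂ q with refl ← isV-true {v = v₂} {k} q = begin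
    (A *ᵥ z) v₂                                  ≡⟨ Az v₂ ⟩
    (c₂ xor (A v₂ v₁ ∧ c₂)) xor (A v₂ v₂ ∧ c₁)  ≡⟨ cong₂ (λ a b → (c₂ xor (a ∧ c₂)) xor (b ∧ c₁)) (trans (symG v₂ v₁) A12) A22 ⟩
    (c₂ xor c₂) xor false                        ≡⟨ xor-identityʳ (c₂ xor c₂) ⟩
    c₂ xor c₂                                    ≡⟨ xor-same c₂ ⟩
    false                                        ∎

  image : ∀ k → (A *ᵥ z) k ≡ (adj (apply G (gdr v₁ v₂)) *ᵥ z′) k
  image k = begin
    (A *ᵥ z) k
      ≡⟨ Az k ⟩
    ((A *ᵥ z′) k xor (A k v₁ ∧ c₂)) xor (A k v₂ ∧ c₁)
      ≡⟨ cong₂ (λ a b → ((A *ᵥ z′) k xor (a ∧ c₂)) xor (b ∧ c₁)) (symG k v₁) (symG k v₂) ⟩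
    ((A *ᵥ z′) k xor (A v₁ k ∧ c₂)) xor (A v₂ k ∧ c₁)
      ≡⟨ xor-assoc ((A *ᵥ z′) k) _ _ ⟩
    (A *ᵥ z′) k xor ((A v₁ k ∧ c₂) xor (A v₂ k ∧ c₁))
      ≡⟨ cong ((A *ᵥ z′) k xor_) (sym (cong₂ _xor_ (·-•ˡ (A v₁ k) (A v₂) z′) (·-•ˡ (A v₂ k) (A v₁) z′))) ⟩
    (A *ᵥ z′) k xor ((A v₁ k • A v₂ · z′) xor (A v₂ k • A v₁ · z′))
      ≡⟨ cong ((A *ᵥ z′) k xor_) (sym (·-⊕ˡ (A v₁ k • A v₂) (A v₂ k • A v₁) z′)) ⟩
    (A *ᵥ z′) k xor (A v₁ k • A v₂ ⊕ A v₂ k • A v₁ · z′)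
      ≡⟨ sym (·-⊕ˡ (A k) (A v₁ k • A v₂ ⊕ A v₂ k • A v₁) z′) ⟩
    (A k ⊕ (A v₁ k • A v₂ ⊕ A v₂ k • A v₁) · z′)
      ∎

-- Deleting an isolated loopless vertex v: z′ itself works, provided z′ is
-- supported on vertices (row v of A vanishes on the vertex set).
lift-gnr : (G : Graph n) (v : Fin n) → Applies G (gnr v) →
           (z′ : Vector Bool n) → (∀ j → z′ j ≡ true → verts G j ≡ true) →
           Lift G (gnr v) z′
lift-gnr G v (_ , Avv , isolated) z′ support =
  lift z′ (λ _ _ → refl) pivot (λ _ → refl)
  where
  A : Matrix _
  A = adj G

  term : ∀ j → A v j ∧ z′ j ≡ false
  term j with z′ j in zj | j ≟ v
  ... | false | _        = ∧-zeroʳ (A v j)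
  ... | true  | yes refl = cong (_∧ true) Avv
  ... | true  | no j≢v   = cong (_∧ true) (isolated j (support j zj) j≢v)

  pivot : ∀ k → isV v k ≡ true → (A *ᵥ z′) k ≡ false
  pivot k p with refl ← isV-true {v = v} {k} p = sum-zero (λ j → A v j ∧ z′ j) term

lift-rule : (G : Graph n) → Symmetric G → (r : Rule n) → Applies G r →
            (z′ : Vector Bool n) → (∀ j → z′ j ≡ true → verts G j ≡ true) →
            Lift G r z′
lift-rule G symG (gpr v) (_ , Avv) z′ _ = lift-gpr G symG v Avv z′
lift-rule G symG (gdr v₁ v₂) (_ , _ , _ , A11 , A22 , A12) z′ _ =
  lift-gdr G symG v₁ v₂ A11 A22 A12 z′
lift-rule G _ (gnr v) ar z′ support = lift-gnr G v ar z′ support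

lift-extension : {G : Graph n} {r : Rule n} {D : Vector Bool n} {y : Fin n} →
                 (z′ : Extension (adj (apply G r)) D y) → Lift G r (vec z′) →
                 Extension (adj G) (λ k → ruleDom r k ∨ D k) y
lift-extension {G = G} {r} {D} {y} z′ L = extension (lifted L) out harm
  where
  out : ∀ k → (ruleDom r k ∨ D k) ≡ false → lifted L k ≡ isV y k
  out k p = trans (agrees L k (∨-conicalˡ (ruleDom r k) _ p))
                  (outside z′ k (∨-conicalʳ (ruleDom r k) _ p))
  harm : ∀ k → (ruleDom r k ∨ D k) ≡ true → (adj G *ᵥ lifted L) k ≡ false
  harm k p with ∨-true p
  ... | inj₁ q = pivoted L k q
  ... | inj₂ q = trans (same-image L k) (harmonic z′ k q)

Computes : Matrix n → Graph n → Fin n → Vector Bool n → Set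
Computes A H y z = ∀ x → verts H x ≡ true → (A *ᵥ z) x ≡ adj H x y

ColumnCertificate : Graph n → Strategy n → Fin n → Set
ColumnCertificate G rs y =
  Σ[ z ∈ Extension (adj G) (dom rs) y ] Computes (adj G) (run G rs) y (vec z)

column-extension : (G : Graph n) → Symmetric G →
                   (rs : Strategy n) → Applicable G rs →
                   {y : Fin n} → verts (run G rs) y ≡ true →
                   ColumnCertificate G rs y
column-extension G symG [] _ {y} _ =
  extension (isV y) (λ _ _ → refl) (λ _ ()) , λ x _ → ·-unitʳ (adj G x) y
column-extension G symG (r ∷ rs) (ar , ars) {y} hy =
  lift-extension z′ L , λ x hx → trans (same-image L x) (computes′ x hx)
  where
  G′ : Graph _
  G′ = apply G r

  IH : ColumnCertificate G′ rs y
  IH = column-extension G′ (symmetric-apply G symG r) rs ars hy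
  z′ : Extension (adj G′) (dom rs) y
  z′ = proj₁ IH

  computes′ : Computes (adj G′) (run G′ rs) y (vec z′)
  computes′ = proj₂ IH

  support : ∀ j → vec z′ j ≡ true → verts G j ≡ true
  support j zj with extension-support z′ j zj
  ... | inj₁ Dj   = ∧-conicalˡ _ _ (dom-⊆ G′ rs ars j Dj)
  ... | inj₂ refl = ∧-conicalˡ _ _ (verts-run-⊆ G′ rs hy)

  L : Lift G r (vec z′)
  L = lift-rule G symG r ar (vec z′) support

mainTheorem11 : ∀ {n : ℕ} (G : Graph n) → Symmetric G →
    (γs δs : Strategy n) → Applicable G γs → Applicable G δs →
    (∀ x → dom γs x ≡ dom δs x) →
    run G γs ≅ run G δs
mainTheorem11 G symG γs δs aγ aδ same-dom = same-verts , same-adj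
  where
  same-verts : ∀ v → verts (run G γs) v ≡ verts (run G δs) v
  same-verts v = begin
    verts (run G γs) v          ≡⟨ verts-run G γs v ⟩
    verts G v ∧ not (dom γs v)  ≡⟨ cong (λ b → verts G v ∧ not b) (same-dom v) ⟩
    verts G v ∧ not (dom δs v)  ≡⟨ sym (verts-run G δs v) ⟩
    verts (run G δs) v          ∎

  same-adj : ∀ x y → verts (run G γs) x ≡ true → verts (run G γs) y ≡ true →
             adj (run G γs) x y ≡ adj (run G δs) x y
  same-adj x y hx hy = begin
    adj (run G γs) x y  ≡⟨ sym (proj₂ zγ x hx) ⟩
    (A *ᵥ vec (proj₁ zγ)) x
      ≡⟨ extension-unique symG (verts-run-∉dom G γs hx) (proj₁ u) (proj₁ zγ) zδ′ ⟩
    (A *ᵥ vec (proj₁ zδ)) x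
      ≡⟨ proj₂ zδ x (trans (sym (same-verts x)) hx) ⟩
    adj (run G δs) x y  ∎
    where
    A : Matrix _
    A = adj G

    u : ColumnCertificate G γs x
    u = column-extension G symG γs aγ hx

    zγ : ColumnCertificate G γs y
    zγ = column-extension G symG γs aγ hy

    zδ : ColumnCertificate G δs y
    zδ = column-extension G symG δs aδ (trans (sym (same-verts y)) hy)

    zδ′ : Extension A (dom γs) y
    zδ′ = extension-cong (λ k → sym (same-dom k)) (proj₁ zδ)
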